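{- Let $\alpha=(i_1^{\alpha_1},\dots,i_m^{\alpha_m})$ be a partition of $n$ (distinct part sizes $i_1,\dots,i_m$ with multiplicities $\alpha_1,\dots,\alpha_m$). Then $$\mathbf{K}_\alpha=\mathbf{C}_{(i_1)}(X^{\alpha_1})\cdot\mathbf{C}_{(i_2)}(X^{\alpha_2})\cdots\mathbf{C}_{(i_m)}(X^{\alpha_m}),$$ as species (up to isomorphism).
   Context: A species is a functor from finite sets with bijections to finite sets; equality of species means natural isomorphism. For $H\le S_n$, $X^n/H$ is the species with $(X^n/H)[U]=\{\lambda H:\lambda:[n]\to U\text{ bijection}\}$ and $(X^n/H)[f](\lambda H)=(f\lambda)H$. For a partition $\beta$ of $k$, the standard permutation $\sigma_\beta\in S_k$ is the product of disjoint cycles filling cycles of lengths $\beta_1,\beta_2,\dots$ with $1,\dots,k$ in increasing order, and $\mathbf{C}_\beta:=X^k/\langle\sigma_\beta\rangle$. $(i^a)$ denotes the partition with $a$ parts equal to $i$. For $\alpha$ as in the claim, $G_\alpha\le S_n$ is the direct product $\langle\tau_1\rangle\times\cdots\times\langle\tau_m\rangle$ where the $\tau_j$ have disjoint supports consisting of consecutive blocks of integers and each $\tau_j$ is a product of $\alpha_j$ disjoint $i_j$-cycles (the standard permutation of shape $(i_j^{\alpha_j})$ placed on its block); $\mathbf{K}_\alpha:=X^n/G_\alpha$, which equals the product species $\mathbf{C}_{(i_m^{\alpha_m})}\cdots\mathbf{C}_{(i_1^{\alpha_1})}$. Here $F\cdot G$ is the product of species ($(F\cdot G)[U]=\bigsqcup_{U=U_1\sqcup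 U_2}F[U_1]\times G[U_2]$), $X^{a}$ is the species of linear orders of length $a$, and $F(G)=F\circ G$ denotes composition (substitution) of species. -}

module Defs where

open import Level using (0ℓ)
open import Data.Nat using (ℕ; zero; suc; _+_; _≤_)
open import Data.Nat.DivMod using (_mod_)
open import Data.Fin using (Fin; zero; suc; toℕ; splitAt; _↑ˡ_; _↑ʳ_)
import Data.Fin.Properties as FinP
open import Data.Bool using (Bool; true; false)
import Data.Bool.Properties as BoolP
open import Data.List using (List; []; _∷_; replicate; length)
open import Data.Nat.ListAction using (sum)
open import Data.Product using (Σ; _×_; _,_; proj₁; proj₂)
open import Data.Sum using (_⊎_; inj₁; inj₂)
open import Data.Unit using (⊤; tt)
open import Data.Empty using (⊥)
open import Function.Bundles using (_↔_; Inverse; mk↔ₛ′)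
open import Function.Construct.Composition using (_↔-∘_)
open import Function.Construct.Identity using (↔-id)
open import Relation.Binary.PropositionalEquality
open import Relation.Binary.Construct.Closure.Equivalence using (EqClosure)
open import Axiom.UniquenessOfIdentityProofs using (module Decidable⇒UIP)

open Inverse

-- A species assigns to every set U a type of "structure representatives"
-- Str U together with an equivalence _≈_ on it (the actual set F[U] is
-- Str U / ≈, i.e. we work with setoids since there are no quotients), and
-- transports structures along bijections.

record Species : Set₁ where
  field
    Str : Set → Set
    _≈_ : ∀ {U} → Str U → Str U → Set
    act : ∀ {U V : Set} → U ↔ V → Str U → Str V

open Species

Finite : Set → Set
Finite U = Σ ℕ (λ k → Fin k ↔ U)

record _≅ₛ_ (A B : Species) : Set₁ where
  field
    φ : ∀ {U} → Finite U → Str A U → Str B U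
    ψ : ∀ {U} → Finite U → Str B U → Str A U
    φ-cong : ∀ {U} (fin : Finite U) {x y : Str A U} →
             _≈_ A x y → _≈_ B (φ fin x) (φ fin y)
    ψ-cong : ∀ {U} (fin : Finite U) {x y : Str B U} →
             _≈_ B x y → _≈_ A (ψ fin x) (ψ fin y)
    ψφ : ∀ {U} (fin : Finite U) (x : Str A U) → _≈_ A (ψ fin (φ fin x)) x
    φψ : ∀ {U} (fin : Finite U) (y : Str B U) → _≈_ B (φ fin (ψ fin y)) y
    natural : ∀ {U V} (finU : Finite U) (finV : Finite V) (f : U ↔ V)
              (x : Str A U) →
              _≈_ B (φ finV (act A f x)) (act B f (φ finU x))

Σ-≡ : {U : Set} {P : U → Set} → (∀ {u} (p q : P u) → p ≡ q) →
      {a b : U} → a ≡ b → (p : P a) (q : P b) →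
      _≡_ {A = Σ U P} (a , p) (b , q)
Σ-≡ irr refl p q = cong (_ ,_) (irr p q)

subMap : {U V : Set} (f : U ↔ V) (P : U → Set) (Q : V → Set) →
         (∀ {u} (p q : P u) → p ≡ q) → (∀ {v} (p q : Q v) → p ≡ q) →
         (∀ u → P u → Q (to f u)) → (∀ v → Q v → P (from f v)) →
         Σ U P ↔ Σ V Q
subMap f P Q irrP irrQ fwd bwd =
  mk↔ₛ′ (λ { (u , p) → to f u , fwd u p })
        (λ { (v , q) → from f v , bwd v q })
        (λ { (v , q) → Σ-≡ irrQ (strictlyInverseˡ f v) _ q })
        (λ { (u , p) → Σ-≡ irrP (strictlyInverseʳ f u) _ p })

Bool-irr : {a b : Bool} (p q : a ≡ b) → p ≡ q
Bool-irr = Decidable⇒UIP.≡-irrelevant BoolP._≟_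

Fin-irr : {n : ℕ} {a b : Fin n} (p q : a ≡ b) → p ≡ q
Fin-irr = Decidable⇒UIP.≡-irrelevant FinP._≟_

-- X^n / H, with H the subgroup of S_n generated by a family g of
-- permutations of Fin n.  Structures on U: bijections λ : Fin n ↔ U;
-- λH = μH iff μ = λ ∘ h for some h ∈ H = ⟨g⟩, i.e. iff λ and μ are related
-- by the equivalence closure of "μ equals λ (pointwise), or μ = λ ∘ g k".

CosetStep : {n : ℕ} {U : Set} {I : Set} (g : I → Fin n → Fin n) →
            (Fin n ↔ U) → (Fin n ↔ U) → Set
CosetStep {n} {U} {I} g l m =
  (∀ i → to m i ≡ to l i) ⊎ Σ I (λ k → ∀ i → to m i ≡ to l (g k i))

XnH : (n : ℕ) {I : Set} (g : I → Fin n → Fin n) → Species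
XnH n g = record
  { Str = λ U → Fin n ↔ U
  ; _≈_ = EqClosure (CosetStep g)
  ; act = λ f l → f ↔-∘ l
  }

Xpow : ℕ → Species
Xpow a = XnH a {⊥} (λ ())

-- Standard permutation σ_β for β given as the list of its parts
-- (β₁, β₂, …): cycles on consecutive blocks, each cycle i ↦ i+1 (mod length).

rot : ∀ {l} → Fin l → Fin l
rot {suc l} x = suc (toℕ x) mod (suc l)

stdPerm : (β : List ℕ) → Fin (sum β) → Fin (sum β)
stdPerm [] x = x
stdPerm (l ∷ β) x with splitAt l x
... | inj₁ a = rot a ↑ˡ sum β
... | inj₂ b = l ↑ʳ stdPerm β b

C : (β : List ℕ) → Species
C β = XnH (sum β) {⊤} (λ _ → stdPerm β)

-- K_α.  α is given as the list of pairs (i_j , α_j) (part size, multiplicity).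

blk : ℕ × ℕ → ℕ
blk (i , a) = sum (replicate a i)

size : List (ℕ × ℕ) → ℕ
size [] = 0
size (p ∷ α) = blk p + size α

tau : (α : List (ℕ × ℕ)) → Fin (length α) → Fin (size α) → Fin (size α)
tau ((i , a) ∷ α) zero x with splitAt (blk (i , a)) x
... | inj₁ y = stdPerm (replicate a i) y ↑ˡ size α
... | inj₂ z = blk (i , a) ↑ʳ z
tau (p ∷ α) (suc j) x with splitAt (blk p) x
... | inj₁ y = y ↑ˡ size α
... | inj₂ z = blk p ↑ʳ tau α j z

-- K_α = X^n / G_α,  G_α = ⟨τ_1⟩ × ⋯ × ⟨τ_m⟩ = ⟨τ_1, …, τ_m⟩
K : List (ℕ × ℕ) → Species
K α = XnH (size α) (tau α)

Sub : {U : Set} → (U → Bool) → Bool → Set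
Sub {U} S b = Σ U (λ u → S u ≡ b)

subAlong : {U V : Set} (f : U ↔ V) (S : U → Bool) (b : Bool) →
           Sub S b ↔ Sub (λ v → S (from f v)) b
subAlong f S b = subMap f _ _ Bool-irr Bool-irr
  (λ u e → trans (cong S (strictlyInverseʳ f u)) e) (λ v e → e)

subEq : {U : Set} {S S' : U → Bool} → (∀ u → S u ≡ S' u) → (b : Bool) →
        Sub S b ↔ Sub S' b
subEq e b = subMap (↔-id _) _ _ Bool-irr Bool-irr
  (λ u q → trans (sym (e u)) q) (λ u q → trans (e u) q)

_·_ : Species → Species → Species
F · G = record
  { Str = λ U → Σ (U → Bool) (λ S → Str F (Sub S true) × Str G (Sub S false))
  ; _≈_ = λ { (S , x , y) (S' , x' , y') →
              Σ (∀ u → S u ≡ S' u) (λ e →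
                _≈_ F (act F (subEq e true) x) x' ×
                _≈_ G (act G (subEq e false) y) y') }
  ; act = λ { f (S , x , y) →
              (λ v → S (from f v)) ,
              act F (subAlong f S true) x ,
              act G (subAlong f S false) y }
  }

One : Species
One = record
  { Str = λ U → U → ⊥
  ; _≈_ = λ _ _ → ⊤
  ; act = λ f e v → e (from f v)
  }

prod : List Species → Species
prod [] = One
prod (F ∷ []) = F
prod (F ∷ G ∷ Fs) = F · prod (G ∷ Fs)

-- A structure on U: a partition of U into r nonempty blocks, presented by a
-- surjection p : U → Fin r (block labels), an F-structure on the set of
-- blocks (labelled by Fin r) and a G-structure on every block; two such are
-- identified when they differ by a relabelling τ of the blocks.

Fib : {U : Set} {r : ℕ} → (U → Fin r) → Fin r → Set
Fib {U} p j = Σ U (λ u → p u ≡ j)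

record CompStr (F G : Species) (U : Set) : Set where
  constructor comp
  field
    r    : ℕ
    blkOf : U → Fin r
    surj : ∀ j → Fib blkOf j
    outer : Str F (Fin r)
    inner : (j : Fin r) → Str G (Fib blkOf j)

fibRelabel : {U : Set} {r r' : ℕ} (p : U → Fin r) (p' : U → Fin r')
             (τ : Fin r ↔ Fin r') → (∀ u → p' u ≡ to τ (p u)) →
             (j : Fin r) → Fib p j ↔ Fib p' (to τ j)
fibRelabel p p' τ e j = subMap (↔-id _) _ _ Fin-irr Fin-irr
  (λ u q → trans (e u) (cong (to τ) q))
  (λ u q → trans (sym (strictlyInverseʳ τ (p u)))
                 (trans (cong (from τ) (trans (sym (e u)) q))
                        (strictlyInverseʳ τ j)))

fibAlong : {U V : Set} {r : ℕ} (f : U ↔ V) (p : U → Fin r) (j : Fin r) →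
           Fib p j ↔ Fib (λ v → p (from f v)) j
fibAlong f p j = subMap f _ _ Fin-irr Fin-irr
  (λ u q → trans (cong p (strictlyInverseʳ f u)) q) (λ v q → q)

_∘ₛ_ : Species → Species → Species
F ∘ₛ G = record
  { Str = CompStr F G
  ; _≈_ = λ { (comp r p s x y) (comp r' p' s' x' y') →
              Σ (Fin r ↔ Fin r') (λ τ →
              Σ (∀ u → p' u ≡ to τ (p u)) (λ e →
                _≈_ F (act F τ x) x' ×
                (∀ j → _≈_ G (act G (fibRelabel p p' τ e j) (y j))
                              (y' (to τ j))))) }
  ; act = λ { f (comp r p s x y) →
              comp r (λ v → p (from f v))
                   (λ j → to (fibAlong f p j) (s j))
                   x
                   (λ j → act G (fibAlong f p j) (y j)) }
  }

module Submission where

-- A K_α-structure on U is a labelling of U by the n positions, taken up to the group generated by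
-- the τ_j. Since the τ_j move disjoint consecutive blocks of positions, a labelling splits into a
-- labelling of the subset S of U hit by the first block and one of its complement, each up to its
-- own generators: K_α = C_{(i_1^{α_1})} · K_{α′}, where α′ drops the first part size, and induction
-- reduces the theorem to a single block. Number the i·a positions of a block as a grid with a rows
-- and i columns on which σ_{(i^a)} rotates the columns. The columns of a labelling partition U into
-- i blocks, each linearly ordered by the rows, and σ_{(i^a)} only rotates the blocks: this is a
-- C_{(i)}-structure on the set of blocks with an X^a-structure on each block.

open import Defs
open import Data.Bool using (Bool; true; false)
open import Data.Empty using (⊥; ⊥-elim)
open import Data.Fin using (Fin; zero; suc; splitAt; join; _↑ˡ_; _↑ʳ_; fromℕ; inject₁; toℕ)
open import Data.Fin.Properties
  using (¬Fin0; +↔⊎; splitAt-↑ˡ; splitAt-↑ʳ; splitAt-join; join-splitAt;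
         toℕ-injective; toℕ-fromℕ<; toℕ-fromℕ; toℕ-inject₁; toℕ<n)
open import Data.Fin.Relation.Unary.Top using (view; ‵fromℕ; ‵inject₁)
open import Data.List using (List; []; _∷_; replicate; length; map)
open import Data.List.Relation.Unary.All as All using (All; []; _∷_)
open import Data.List.Relation.Unary.Unique.Propositional using (Unique)
open import Data.Nat using (ℕ; zero; suc; _+_; _≤_; s≤s)
open import Data.Nat.DivMod using (_%_; n%n≡0; m<n⇒m%n≡m)
open import Data.Product using (Σ; _×_; _,_; proj₁; proj₂)
import Data.Product as Product
open import Data.Product.Function.NonDependent.Propositional using (_×-↔_)
open import Data.Sum using (_⊎_; inj₁; inj₂)
import Data.Sum as Sum
open import Data.Sum.Function.Propositional using (_⊎-↔_)
open import Data.Sum.Properties using ([,]-cong; [,]-map; [,]-∘)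
open import Data.Unit using (⊤; tt)
open import Function.Base using (id; _∘_; const)
open import Function.Bundles using (_↔_; Inverse; mk↔ₛ′)
open import Function.Construct.Composition using (_↔-∘_)
open import Function.Construct.Identity using (↔-id)
open import Function.Construct.Symmetry using (↔-sym)
open import Relation.Nullary using (contradiction)
open import Relation.Binary.PropositionalEquality
import Relation.Binary.Construct.Closure.Equivalence as EqClosure
open import Relation.Binary.Construct.Closure.ReflexiveTransitive using (ε; _◅_; _◅◅_)
import Relation.Binary.Construct.Closure.ReflexiveTransitive as Star
open import Relation.Binary.Construct.Closure.Symmetric using (SymClosure; fwd; bwd)

open Inverse
open ≡-Reasoning

-- Lawful species and their isomorphisms

from-≗ : {U V : Set} (f g : U ↔ V) → to f ≗ to g → from f ≗ from g
from-≗ f g f≗g v = begin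
  from f v                  ≡⟨ strictlyInverseʳ g (from f v) ⟨
  from g (to g (from f v))  ≡⟨ cong (from g) (f≗g (from f v)) ⟨
  from g (to f (from f v))  ≡⟨ cong (from g) (strictlyInverseˡ f v) ⟩
  from g v                  ∎

Sub-≡ : {U : Set} {S : U → Bool} {b : Bool} {x y : Sub S b} → proj₁ x ≡ proj₁ y → x ≡ y
Sub-≡ {x = x} {y} eq = Σ-≡ Bool-irr eq (proj₂ x) (proj₂ y)

Fib-≡ : {U : Set} {r : ℕ} {p : U → Fin r} {j : Fin r} {x y : Fib p j} → proj₁ x ≡ proj₁ y → x ≡ y
Fib-≡ {x = x} {y} eq = Σ-≡ Fin-irr eq (proj₂ x) (proj₂ y)

-- The relations _≈_ of Defs are only shown reflexive and transitive: symmetry for F ∘ₛ G would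
-- need transport along the relabelling of blocks. Laws are therefore stated in both orientations.
record Lawful (F : Species) : Set₁ where
  open Species F public
  field
    ≈-refl   : ∀ {U} {x : Str U} → x ≈ x
    ≈-trans  : ∀ {U} {x y z : Str U} → x ≈ y → y ≈ z → x ≈ z
    act-cong : ∀ {U V} (f : U ↔ V) {x y : Str U} → x ≈ y → act f x ≈ act f y
    act-id   : ∀ {U} {h : U ↔ U} → to h ≗ id → ∀ x → act h x ≈ x
    act-id˘  : ∀ {U} {h : U ↔ U} → to h ≗ id → ∀ x → x ≈ act h x
    act-∘    : ∀ {U V W} {f : U ↔ V} {g : V ↔ W} {h : U ↔ W} →
               to g ∘ to f ≗ to h → ∀ x → act g (act f x) ≈ act h x
    act-∘˘   : ∀ {U V W} {f : U ↔ V} {g : V ↔ W} {h : U ↔ W} →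
               to g ∘ to f ≗ to h → ∀ x → act h x ≈ act g (act f x)

  act-ext : ∀ {U V} {f g : U ↔ V} → to f ≗ to g → ∀ x → act f x ≈ act g x
  act-ext {f = f} f≗g x = ≈-trans (act-id˘ {h = ↔-id _} (λ _ → refl) (act f x)) (act-∘ f≗g x)

  act-∘-id : ∀ {U V} {f : U ↔ V} {g : V ↔ U} → to g ∘ to f ≗ id → ∀ x → act g (act f x) ≈ x
  act-∘-id eq x = ≈-trans (act-∘ {h = ↔-id _} eq x) (act-id (λ _ → refl) x)

  act-square : ∀ {U V V′ W} {f : U ↔ V} {g : V ↔ W} {f′ : U ↔ V′} {g′ : V′ ↔ W} →
               to g ∘ to f ≗ to g′ ∘ to f′ → ∀ x → act g (act f x) ≈ act g′ (act f′ x)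
  act-square {f′ = f′} {g′} eq x = ≈-trans (act-∘ {h = g′ ↔-∘ f′} eq x) (act-∘˘ (λ _ → refl) x)

  act-∘₃ : ∀ {U V W X} {f : U ↔ V} {g : V ↔ W} {k : W ↔ X} {h : U ↔ X} →
           to k ∘ to g ∘ to f ≗ to h → ∀ x → act k (act g (act f x)) ≈ act h x
  act-∘₃ {f = f} {g} {k} eq x = ≈-trans (act-cong k (act-∘ {h = g ↔-∘ f} (λ _ → refl) x)) (act-∘ eq x)

module _ {n : ℕ} {I : Set} (g : I → Fin n → Fin n) where
  private module X = Species (XnH n g)

  coset-≗ : ∀ {U} {l m : Fin n ↔ U} → to m ≗ to l → l X.≈ m
  coset-≗ m≗l = fwd (inj₁ m≗l) ◅ ε

  coset-step : ∀ {U} {l m : Fin n ↔ U} (k : I) → (∀ i → to m i ≡ to l (g k i)) → l X.≈ m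
  coset-step k eq = fwd (inj₂ (k , eq)) ◅ ε

  coset-step˘ : ∀ {U} {l m : Fin n ↔ U} (k : I) → (∀ i → to l i ≡ to m (g k i)) → l X.≈ m
  coset-step˘ k eq = bwd (inj₂ (k , eq)) ◅ ε

  XnH-lawful : Lawful (XnH n g)
  XnH-lawful = record
    { ≈-refl   = ε
    ; ≈-trans  = _◅◅_
    ; act-cong = λ f →
        EqClosure.gmap (f ↔-∘_) (Sum.map (cong (to f) ∘_) (Product.map₂ (cong (to f) ∘_)))
    ; act-id   = λ h≗id l → coset-≗ (λ i → sym (h≗id (to l i)))
    ; act-id˘  = λ h≗id l → coset-≗ (λ i → h≗id (to l i))
    ; act-∘    = λ eq l → coset-≗ (λ i → sym (eq (to l i)))
    ; act-∘˘   = λ eq l → coset-≗ (λ i → eq (to l i))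
    }

One-lawful : Lawful One
One-lawful = record
  { ≈-refl = tt ; ≈-trans = λ _ _ → tt ; act-cong = λ _ _ → tt
  ; act-id = λ _ _ → tt ; act-id˘ = λ _ _ → tt ; act-∘ = λ _ _ → tt ; act-∘˘ = λ _ _ → tt }

module _ {F G : Species} (LF : Lawful F) (LG : Lawful G) where
  private
    module F = Lawful LF
    module G = Lawful LG
    module FG = Species (F · G)

  ·-≈ : ∀ {U} {S : U → Bool} {x x′ y y′} → x F.≈ x′ → y G.≈ y′ → (S , x , y) FG.≈ (S , x′ , y′)
  ·-≈ {x = x} {y = y} x≈x′ y≈y′ =
    (λ _ → refl) ,
    F.≈-trans (F.act-id (λ _ → Sub-≡ refl) x) x≈x′ ,
    G.≈-trans (G.act-id (λ _ → Sub-≡ refl) y) y≈y′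

  ·-lawful : Lawful (F · G)
  ·-lawful = record
    { ≈-refl   = ·-≈ F.≈-refl G.≈-refl
    ; ≈-trans  = λ { {x = _ , x , y} (e₁ , x₁ , y₁) (e₂ , x₂ , y₂) →
        (λ u → trans (e₁ u) (e₂ u)) ,
        F.≈-trans (F.act-∘˘ (λ _ → Sub-≡ refl) x) (F.≈-trans (F.act-cong _ x₁) x₂) ,
        G.≈-trans (G.act-∘˘ (λ _ → Sub-≡ refl) y) (G.≈-trans (G.act-cong _ y₁) y₂) }
    ; act-cong = λ { f {_ , x , y} (e , x₁ , y₁) →
        (λ v → e (from f v)) ,
        F.≈-trans (F.act-square (λ _ → Sub-≡ refl) x) (F.act-cong _ x₁) ,
        G.≈-trans (G.act-square (λ _ → Sub-≡ refl) y) (G.act-cong _ y₁) }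
    ; act-id   = λ { {h = h} h≗id (S , x , y) →
        (λ u → cong S (from-≗ h (↔-id _) h≗id u)) ,
        F.act-∘-id (λ w → Sub-≡ (h≗id (proj₁ w))) x ,
        G.act-∘-id (λ w → Sub-≡ (h≗id (proj₁ w))) y }
    ; act-id˘  = λ { {h = h} h≗id (S , x , y) →
        (λ u → cong S (sym (from-≗ h (↔-id _) h≗id u))) ,
        F.act-ext (λ w → Sub-≡ (sym (h≗id (proj₁ w)))) x ,
        G.act-ext (λ w → Sub-≡ (sym (h≗id (proj₁ w)))) y }
    ; act-∘    = λ { {f = f} {g} {h} eq (S , x , y) →
        (λ w → cong S (from-≗ (g ↔-∘ f) h eq w)) ,
        F.act-∘₃ (λ w → Sub-≡ (eq (proj₁ w))) x ,
        G.act-∘₃ (λ w → Sub-≡ (eq (proj₁ w))) y }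
    ; act-∘˘   = λ { {f = f} {g} {h} eq (S , x , y) →
        (λ w → cong S (sym (from-≗ (g ↔-∘ f) h eq w))) ,
        F.act-square (λ w → Sub-≡ (sym (eq (proj₁ w)))) x ,
        G.act-square (λ w → Sub-≡ (sym (eq (proj₁ w)))) y }
    }

module _ {F G : Species} (LF : Lawful F) (LG : Lawful G) where
  private
    module F = Lawful LF
    module G = Lawful LG

  ∘ₛ-lawful : Lawful (F ∘ₛ G)
  ∘ₛ-lawful = record
    { ≈-refl   = λ { {x = comp r p s x y} →
        ↔-id _ , (λ _ → refl) , F.act-id (λ _ → refl) x , λ j → G.act-id (λ _ → Fib-≡ refl) (y j) }
    ; ≈-trans  = λ { {x = comp r p s x y} (τ₁ , e₁ , x₁ , y₁) (τ₂ , e₂ , x₂ , y₂) →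
        τ₂ ↔-∘ τ₁ , (λ u → trans (e₂ u) (cong (to τ₂) (e₁ u))) ,
        F.≈-trans (F.act-∘˘ (λ _ → refl) x) (F.≈-trans (F.act-cong τ₂ x₁) x₂) ,
        λ j → G.≈-trans (G.act-∘˘ (λ _ → Fib-≡ refl) (y j))
                        (G.≈-trans (G.act-cong _ (y₁ j)) (y₂ (to τ₁ j))) }
    ; act-cong = λ { f {comp r p s x y} (τ , e , x₁ , y₁) →
        τ , (λ v → e (from f v)) , x₁ ,
        λ j → G.≈-trans (G.act-square (λ _ → Fib-≡ refl) (y j)) (G.act-cong _ (y₁ j)) }
    ; act-id   = λ { {h = h} h≗id (comp r p s x y) →
        ↔-id _ , (λ u → cong p (sym (from-≗ h (↔-id _) h≗id u))) , F.act-id (λ _ → refl) x ,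
        λ j → G.act-∘-id (λ w → Fib-≡ (h≗id (proj₁ w))) (y j) }
    ; act-id˘  = λ { {h = h} h≗id (comp r p s x y) →
        ↔-id _ , (λ u → cong p (from-≗ h (↔-id _) h≗id u)) , F.act-id (λ _ → refl) x ,
        λ j → G.act-ext (λ w → Fib-≡ (sym (h≗id (proj₁ w)))) (y j) }
    ; act-∘    = λ { {f = f} {g} {h} eq (comp r p s x y) →
        ↔-id _ , (λ w → cong p (sym (from-≗ (g ↔-∘ f) h eq w))) , F.act-id (λ _ → refl) x ,
        λ j → G.act-∘₃ (λ w → Fib-≡ (eq (proj₁ w))) (y j) }
    ; act-∘˘   = λ { {f = f} {g} {h} eq (comp r p s x y) →
        ↔-id _ , (λ w → cong p (from-≗ (g ↔-∘ f) h eq w)) , F.act-id (λ _ → refl) x ,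
        λ j → G.act-square (λ w → Fib-≡ (sym (eq (proj₁ w)))) (y j) }
    }

-- natural˘ and ψ-natural˘ do not follow from the other fields, ≈ not being known to be symmetric.
record _≃_ (F G : Species) : Set₁ where
  private
    module F = Species F
    module G = Species G
  field
    φ          : ∀ {U} → F.Str U → G.Str U
    ψ          : ∀ {U} → G.Str U → F.Str U
    φ-cong     : ∀ {U} {x y : F.Str U} → x F.≈ y → φ x G.≈ φ y
    ψ-cong     : ∀ {U} {x y : G.Str U} → x G.≈ y → ψ x F.≈ ψ y
    ψφ         : ∀ {U} (x : F.Str U) → ψ (φ x) F.≈ x
    φψ         : ∀ {U} (y : G.Str U) → φ (ψ y) G.≈ y
    natural    : ∀ {U V} (f : U ↔ V) (x : F.Str U) → φ (F.act f x) G.≈ G.act f (φ x)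
    natural˘   : ∀ {U V} (f : U ↔ V) (x : F.Str U) → G.act f (φ x) G.≈ φ (F.act f x)
    ψ-natural˘ : ∀ {U V} (f : U ↔ V) (y : G.Str U) → F.act f (ψ y) F.≈ ψ (G.act f y)

≃⇒≅ₛ : ∀ {F G} → F ≃ G → F ≅ₛ G
≃⇒≅ₛ F≃G = record
  { φ = λ _ → φ ; ψ = λ _ → ψ ; φ-cong = λ _ → φ-cong ; ψ-cong = λ _ → ψ-cong
  ; ψφ = λ _ → ψφ ; φψ = λ _ → φψ ; natural = λ _ _ → natural }
  where open _≃_ F≃G

≃-trans : ∀ {F G H} → Lawful F → Lawful H → F ≃ G → G ≃ H → F ≃ H
≃-trans LF LH I J = record
  { φ          = J.φ ∘ I.φ
  ; ψ          = I.ψ ∘ J.ψ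
  ; φ-cong     = J.φ-cong ∘ I.φ-cong
  ; ψ-cong     = I.ψ-cong ∘ J.ψ-cong
  ; ψφ         = λ x → F.≈-trans (I.ψ-cong (J.ψφ (I.φ x))) (I.ψφ x)
  ; φψ         = λ z → H.≈-trans (J.φ-cong (I.φψ (J.ψ z))) (J.φψ z)
  ; natural    = λ f x → H.≈-trans (J.φ-cong (I.natural f x)) (J.natural f (I.φ x))
  ; natural˘   = λ f x → H.≈-trans (J.natural˘ f (I.φ x)) (J.φ-cong (I.natural˘ f x))
  ; ψ-natural˘ = λ f z → F.≈-trans (I.ψ-natural˘ f (J.ψ z)) (I.ψ-cong (J.ψ-natural˘ f z))
  }
  where
  module I = _≃_ I
  module J = _≃_ J
  module F = Lawful LF
  module H = Lawful LH

module _ {F G F′ G′ : Species}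
         (LF : Lawful F) (LG : Lawful G) (LF′ : Lawful F′) (LG′ : Lawful G′) where
  private
    module F = Lawful LF
    module G = Lawful LG
    module F′ = Lawful LF′
    module G′ = Lawful LG′

  ·-cong : F ≃ F′ → G ≃ G′ → (F · G) ≃ (F′ · G′)
  ·-cong I J = record
    { φ          = Product.map₂ (Product.map I.φ J.φ)
    ; ψ          = Product.map₂ (Product.map I.ψ J.ψ)
    ; φ-cong     = λ { {x = _ , x , y} (e , x≈ , y≈) →
        e , F′.≈-trans (I.natural˘ _ x) (I.φ-cong x≈) , G′.≈-trans (J.natural˘ _ y) (J.φ-cong y≈) }
    ; ψ-cong     = λ { {x = _ , x , y} (e , x≈ , y≈) →
        e , F.≈-trans (I.ψ-natural˘ _ x) (I.ψ-cong x≈) , G.≈-trans (J.ψ-natural˘ _ y) (J.ψ-cong y≈) }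
    ; ψφ         = λ { (_ , x , y) → ·-≈ LF LG (I.ψφ x) (J.ψφ y) }
    ; φψ         = λ { (_ , x , y) → ·-≈ LF′ LG′ (I.φψ x) (J.φψ y) }
    ; natural    = λ { f (_ , x , y) → ·-≈ LF′ LG′ (I.natural _ x) (J.natural _ y) }
    ; natural˘   = λ { f (_ , x , y) → ·-≈ LF′ LG′ (I.natural˘ _ x) (J.natural˘ _ y) }
    ; ψ-natural˘ = λ { f (_ , x , y) → ·-≈ LF LG (I.ψ-natural˘ _ x) (J.ψ-natural˘ _ y) }
    }
    where
    module I = _≃_ I
    module J = _≃_ J

module _ {n : ℕ} {I : Set} {g : I → Fin n → Fin n} {F : Species} (LF : Lawful F) where
  private module F = Lawful LF

  XnH-map-cong : (φ : ∀ {U} → (Fin n ↔ U) → F.Str U) →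
    (∀ {U} (l m : Fin n ↔ U) → to m ≗ to l → φ l F.≈ φ m) →
    (∀ {U} (l m : Fin n ↔ U) k → (∀ i → to m i ≡ to l (g k i)) → φ l F.≈ φ m × φ m F.≈ φ l) →
    ∀ {U} {l m : Fin n ↔ U} → Species._≈_ (XnH n g) l m → φ l F.≈ φ m
  XnH-map-cong φ pointwise generator = Star.gfold φ F._≈_ (λ s → F.≈-trans (step s)) F.≈-refl
    where
    step : ∀ {U} {l m : Fin n ↔ U} → SymClosure (CosetStep g) l m → φ l F.≈ φ m
    step {l = l} {m} (fwd (inj₁ e))       = pointwise l m e
    step {l = l} {m} (fwd (inj₂ (k , e))) = proj₁ (generator l m k e)
    step {l = l} {m} (bwd (inj₁ e))       = pointwise l m (sym ∘ e)
    step {l = l} {m} (bwd (inj₂ (k , e))) = proj₂ (generator m l k e)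

module _ {n n′ : ℕ} {I I′ : Set} (g : I → Fin n → Fin n) (g′ : I′ → Fin n′ → Fin n′)
         (c : Fin n ↔ Fin n′) where

  Intertwines : I → I′ → Set
  Intertwines k k′ = ∀ i → g′ k′ (to c i) ≡ to c (g k i)

  XnH-conj : (∀ k → Σ I′ (Intertwines k)) → (∀ k′ → Σ I (λ k → Intertwines k k′)) →
             XnH n g ≃ XnH n′ g′
  XnH-conj forth back = record
    { φ          = φ
    ; ψ          = ψ
    ; φ-cong     = EqClosure.gmap φ (λ {l} {m} → φ-step l m)
    ; ψ-cong     = EqClosure.gmap ψ (λ {l} {m} → ψ-step l m)
    ; ψφ         = λ l → coset-≗ g (λ i → cong (to l) (sym (strictlyInverseʳ c i)))
    ; φψ         = λ l → coset-≗ g′ (λ i → cong (to l) (sym (strictlyInverseˡ c i)))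
    ; natural    = λ _ _ → coset-≗ g′ (λ _ → refl)
    ; natural˘   = λ _ _ → coset-≗ g′ (λ _ → refl)
    ; ψ-natural˘ = λ _ _ → coset-≗ g (λ _ → refl)
    }
    where
    φ : ∀ {U} → (Fin n ↔ U) → (Fin n′ ↔ U)
    φ l = l ↔-∘ ↔-sym c
    ψ : ∀ {U} → (Fin n′ ↔ U) → (Fin n ↔ U)
    ψ l = l ↔-∘ c

    intertwines˘ : ∀ {k k′} → Intertwines k k′ → ∀ i → from c (g′ k′ i) ≡ g k (from c i)
    intertwines˘ {k} {k′} eq i = begin
      from c (g′ k′ i)                ≡⟨ cong (from c ∘ g′ k′) (strictlyInverseˡ c i) ⟨
      from c (g′ k′ (to c (from c i))) ≡⟨ cong (from c) (eq (from c i)) ⟩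
      from c (to c (g k (from c i)))   ≡⟨ strictlyInverseʳ c _ ⟩
      g k (from c i)                  ∎

    φ-step : ∀ {U} (l m : Fin n ↔ U) → CosetStep g l m → CosetStep g′ (φ l) (φ m)
    φ-step l m (inj₁ e)       = inj₁ (e ∘ from c)
    φ-step l m (inj₂ (k , e)) = inj₂ (proj₁ (forth k) , λ i →
      trans (e (from c i)) (cong (to l) (sym (intertwines˘ (proj₂ (forth k)) i))))

    ψ-step : ∀ {U} (l m : Fin n′ ↔ U) → CosetStep g′ l m → CosetStep g (ψ l) (ψ m)
    ψ-step l m (inj₁ e)       = inj₁ (e ∘ to c)
    ψ-step l m (inj₂ (k′ , e)) = inj₂ (proj₁ (back k′) , λ i →
      trans (e (to c i)) (cong (to l) (proj₂ (back k′) i)))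

-- Labellings of two blocks

isLeft : {A B : Set} → A ⊎ B → Bool
isLeft = Sum.[ const true , const false ]

module _ {U : Set} (S : U → Bool) where
  private
    select : (u : U) (b : Bool) → S u ≡ b → Sub S true ⊎ Sub S false
    select u true  q = inj₁ (u , q)
    select u false q = inj₂ (u , q)

    proj₁-select : ∀ {u} b (q : S u ≡ b) → Sum.[ proj₁ , proj₁ ] (select u b q) ≡ u
    proj₁-select true  q = refl
    proj₁-select false q = refl

    select-unique : ∀ {u b} (q : S u ≡ b) b′ (q′ : S u ≡ b′) → select u b′ q′ ≡ select u b q
    select-unique {b = true}  q true  q′ = cong inj₁ (Sub-≡ refl)
    select-unique {b = false} q false q′ = cong inj₂ (Sub-≡ refl)
    select-unique {b = true}  q false q′ = contradiction (trans (sym q) q′) λ ()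
    select-unique {b = false} q true  q′ = contradiction (trans (sym q) q′) λ ()

    select-proj₁ : ∀ w → select (Sum.[ proj₁ , proj₁ ] w) _ refl ≡ w
    select-proj₁ (inj₁ (u , q)) = select-unique q _ refl
    select-proj₁ (inj₂ (u , q)) = select-unique q _ refl

    isLeft-select : ∀ {u} b (q : S u ≡ b) → isLeft (select u b q) ≡ b
    isLeft-select true  q = refl
    isLeft-select false q = refl

  partition↔ : (Sub S true ⊎ Sub S false) ↔ U
  partition↔ = mk↔ₛ′ Sum.[ proj₁ , proj₁ ] (λ u → select u (S u) refl)
                     (λ u → proj₁-select (S u) refl) select-proj₁

  isLeft-partition : ∀ u → isLeft (from partition↔ u) ≡ S u
  isLeft-partition u = isLeft-select (S u) refl

module _ {X Y : Set} where

  inj₁↔ : X ↔ Sub (isLeft {X} {Y}) true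
  inj₁↔ = mk↔ₛ′ (λ x → inj₁ x , refl) (λ { (inj₁ x , _) → x ; (inj₂ _ , ()) })
                (λ { (inj₁ x , _) → Sub-≡ refl ; (inj₂ _ , ()) }) (λ _ → refl)

  inj₂↔ : Y ↔ Sub (isLeft {X} {Y}) false
  inj₂↔ = mk↔ₛ′ (λ y → inj₂ y , refl) (λ { (inj₁ _ , ()) ; (inj₂ y , _) → y })
                (λ { (inj₁ _ , ()) ; (inj₂ y , _) → Sub-≡ refl }) (λ _ → refl)

  module _ {U : Set} (h : (X ⊎ Y) ↔ U) where

    restrictˡ : X ↔ Sub (isLeft ∘ from h) true
    restrictˡ = subAlong h isLeft true ↔-∘ inj₁↔

    restrictʳ : Y ↔ Sub (isLeft ∘ from h) false
    restrictʳ = subAlong h isLeft false ↔-∘ inj₂↔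

isLeft-map : ∀ {A B C D : Set} {f : A → B} {g : C → D} s → isLeft (Sum.map f g s) ≡ isLeft s
isLeft-map (inj₁ _) = refl
isLeft-map (inj₂ _) = refl

_⊕_ : ∀ {m n} → (Fin m → Fin m) → (Fin n → Fin n) → Fin (m + n) → Fin (m + n)
_⊕_ {m} {n} f g = join m n ∘ Sum.map f g ∘ splitAt m

module _ {m n : ℕ} (f : Fin m → Fin m) (g : Fin n → Fin n) where

  ⊕-↑ˡ : ∀ a → (f ⊕ g) (a ↑ˡ n) ≡ f a ↑ˡ n
  ⊕-↑ˡ a = cong (join m n ∘ Sum.map f g) (splitAt-↑ˡ m a n)

  ⊕-↑ʳ : ∀ b → (f ⊕ g) (m ↑ʳ b) ≡ m ↑ʳ g b
  ⊕-↑ʳ b = cong (join m n ∘ Sum.map f g) (splitAt-↑ʳ m n b)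

  isLeft-⊕ : ∀ x → isLeft (splitAt m ((f ⊕ g) x)) ≡ isLeft (splitAt m x)
  isLeft-⊕ x =
    trans (cong isLeft (splitAt-join m n (Sum.map f g (splitAt m x)))) (isLeft-map (splitAt m x))

blockwise : ∀ {m n} {I J : Set} → (I → Fin m → Fin m) → (J → Fin n → Fin n) →
            I ⊎ J → Fin (m + n) → Fin (m + n)
blockwise g h = Sum.[ (λ k → g k ⊕ id) , (λ k → id ⊕ h k) ]

module _ {m n : ℕ} {I J : Set} (g : I → Fin m → Fin m) (h : J → Fin n → Fin n) where
  private
    module Src = Species (XnH (m + n) (blockwise g h))
    Tgt : Species
    Tgt = XnH m g · XnH n h
    module Tgt = Lawful (·-lawful (XnH-lawful g) (XnH-lawful h))

    split : ∀ {U : Set} → (Fin (m + n) ↔ U) → (Fin m ⊎ Fin n) ↔ U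
    split l = l ↔-∘ ↔-sym +↔⊎

    side : ∀ {U : Set} → (Fin (m + n) ↔ U) → U → Bool
    side l = isLeft ∘ from (split l)

    φ : ∀ {U} → (Fin (m + n) ↔ U) → Tgt.Str U
    φ l = side l , restrictˡ (split l) , restrictʳ (split l)

    ψ : ∀ {U} → Tgt.Str U → (Fin (m + n) ↔ U)
    ψ (S , x , y) = partition↔ S ↔-∘ ((x ⊎-↔ y) ↔-∘ +↔⊎)

    to-ψ : ∀ {U} {S : U → Bool} x y →
           to (ψ (S , x , y)) ≗ Sum.[ proj₁ ∘ to x , proj₁ ∘ to y ] ∘ splitAt m
    to-ψ x y i = [,]-map (splitAt m i)

    ψ-⊕ : ∀ {U} {S₁ S₂ : U → Bool} x₁ y₁ x₂ y₂ (f : Fin m → Fin m) (f′ : Fin n → Fin n) →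
          (∀ a → proj₁ (to x₂ a) ≡ proj₁ (to x₁ (f a))) →
          (∀ b → proj₁ (to y₂ b) ≡ proj₁ (to y₁ (f′ b))) →
          to (ψ (S₂ , x₂ , y₂)) ≗ to (ψ (S₁ , x₁ , y₁)) ∘ (f ⊕ f′)
    ψ-⊕ {S₁ = S₁} {S₂} x₁ y₁ x₂ y₂ f f′ eqˡ eqʳ i = begin
      to (ψ (S₂ , x₂ , y₂)) i
        ≡⟨ to-ψ x₂ y₂ i ⟩
      Sum.[ proj₁ ∘ to x₂ , proj₁ ∘ to y₂ ] (splitAt m i)
        ≡⟨ [,]-cong eqˡ eqʳ (splitAt m i) ⟩
      Sum.[ proj₁ ∘ to x₁ ∘ f , proj₁ ∘ to y₁ ∘ f′ ] (splitAt m i)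
        ≡⟨ [,]-map (splitAt m i) ⟨
      Sum.[ proj₁ ∘ to x₁ , proj₁ ∘ to y₁ ] (Sum.map f f′ (splitAt m i))
        ≡⟨ cong Sum.[ _ , _ ] (splitAt-join m n (Sum.map f f′ (splitAt m i))) ⟨
      Sum.[ proj₁ ∘ to x₁ , proj₁ ∘ to y₁ ] (splitAt m ((f ⊕ f′) i))
        ≡⟨ to-ψ x₁ y₁ _ ⟨
      to (ψ (S₁ , x₁ , y₁)) ((f ⊕ f′) i)
        ∎

    ψ-≗ : ∀ {U} {S₁ S₂ : U → Bool} x₁ y₁ x₂ y₂ →
          (∀ a → proj₁ (to x₂ a) ≡ proj₁ (to x₁ a)) → (∀ b → proj₁ (to y₂ b) ≡ proj₁ (to y₁ b)) →
          to (ψ (S₂ , x₂ , y₂)) ≗ to (ψ (S₁ , x₁ , y₁))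
    ψ-≗ x₁ y₁ x₂ y₂ eqˡ eqʳ i =
      trans (to-ψ x₂ y₂ i) (trans ([,]-cong eqˡ eqʳ (splitAt m i)) (sym (to-ψ x₁ y₁ i)))

    ψ-↑ˡ : ∀ {U} {S : U → Bool} x y a → to (ψ (S , x , y)) (a ↑ˡ n) ≡ proj₁ (to x a)
    ψ-↑ˡ x y a = trans (to-ψ x y _) (cong Sum.[ _ , _ ] (splitAt-↑ˡ m a n))

    ψ-↑ʳ : ∀ {U} {S : U → Bool} x y b → to (ψ (S , x , y)) (m ↑ʳ b) ≡ proj₁ (to y b)
    ψ-↑ʳ x y b = trans (to-ψ x y _) (cong Sum.[ _ , _ ] (splitAt-↑ʳ m n b))

    isLeft-blockwise : ∀ k x → isLeft (splitAt m (blockwise g h k x)) ≡ isLeft (splitAt m x)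
    isLeft-blockwise (inj₁ k) = isLeft-⊕ (g k) id
    isLeft-blockwise (inj₂ k) = isLeft-⊕ id (h k)

    side-step : ∀ {U} (l m′ : Fin (m + n) ↔ U) k → (∀ i → to m′ i ≡ to l (blockwise g h k i)) →
                ∀ u → side l u ≡ side m′ u
    side-step l m′ k eq u = begin
      side l u                                  ≡⟨ cong (side l) (strictlyInverseˡ m′ u) ⟨
      side l (to m′ (from m′ u))                ≡⟨ cong (side l) (eq (from m′ u)) ⟩
      side l (to l (blockwise g h k (from m′ u))) ≡⟨ cong (isLeft ∘ splitAt m) (strictlyInverseʳ l _) ⟩
      isLeft (splitAt m (blockwise g h k (from m′ u))) ≡⟨ isLeft-blockwise k (from m′ u) ⟩
      side m′ u                                 ∎

    φ-pointwise : ∀ {U : Set} (l m′ : Fin (m + n) ↔ U) → to m′ ≗ to l → φ l Tgt.≈ φ m′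
    φ-pointwise l m′ m′≗l =
      (λ u → cong (isLeft ∘ splitAt m) (from-≗ l m′ (sym ∘ m′≗l) u)) ,
      coset-≗ g (λ a → Sub-≡ (m′≗l (a ↑ˡ n))) ,
      coset-≗ h (λ b → Sub-≡ (m′≗l (m ↑ʳ b)))

    φ-generator : ∀ {U : Set} (l m′ : Fin (m + n) ↔ U) k →
                  (∀ i → to m′ i ≡ to l (blockwise g h k i)) → φ l Tgt.≈ φ m′ × φ m′ Tgt.≈ φ l
    φ-generator l m′ (inj₁ k) eq =
      (side-step l m′ (inj₁ k) eq ,
       coset-step g k (λ a → Sub-≡ (eqˡ a)) , coset-≗ h (λ b → Sub-≡ (eqʳ b))) ,
      (sym ∘ side-step l m′ (inj₁ k) eq ,
       coset-step˘ g k (λ a → Sub-≡ (eqˡ a)) , coset-≗ h (λ b → Sub-≡ (sym (eqʳ b))))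
      where
      eqˡ : ∀ a → to m′ (a ↑ˡ n) ≡ to l (g k a ↑ˡ n)
      eqˡ a = trans (eq (a ↑ˡ n)) (cong (to l) (⊕-↑ˡ (g k) id a))
      eqʳ : ∀ b → to m′ (m ↑ʳ b) ≡ to l (m ↑ʳ b)
      eqʳ b = trans (eq (m ↑ʳ b)) (cong (to l) (⊕-↑ʳ (g k) id b))
    φ-generator l m′ (inj₂ k) eq =
      (side-step l m′ (inj₂ k) eq ,
       coset-≗ g (λ a → Sub-≡ (eqˡ a)) , coset-step h k (λ b → Sub-≡ (eqʳ b))) ,
      (sym ∘ side-step l m′ (inj₂ k) eq ,
       coset-≗ g (λ a → Sub-≡ (sym (eqˡ a))) , coset-step˘ h k (λ b → Sub-≡ (eqʳ b)))
      where
      eqˡ : ∀ a → to m′ (a ↑ˡ n) ≡ to l (a ↑ˡ n)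
      eqˡ a = trans (eq (a ↑ˡ n)) (cong (to l) (⊕-↑ˡ id (h k) a))
      eqʳ : ∀ b → to m′ (m ↑ʳ b) ≡ to l (m ↑ʳ h k b)
      eqʳ b = trans (eq (m ↑ʳ b)) (cong (to l) (⊕-↑ʳ id (h k) b))

    ψ-cong : ∀ {U} {w w′ : Tgt.Str U} → w Tgt.≈ w′ → ψ w Src.≈ ψ w′
    ψ-cong {w = S , x , y} {S′ , x′ , y′} (e , x≈ , y≈) =
      coset-≗ (blockwise g h) (ψ-≗ x y (subEq e true ↔-∘ x) y₁ (λ _ → refl) (λ _ → refl)) ◅◅
      EqClosure.gmap (λ x₁ → ψ (S′ , x₁ , y₁)) (λ {x₁} {x₂} → left-step x₁ x₂) x≈ ◅◅
      EqClosure.gmap (λ y₂ → ψ (S′ , x′ , y₂)) (λ {y₂} {y₃} → right-step y₂ y₃) y≈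
      where
      y₁ : Fin n ↔ Sub S′ false
      y₁ = subEq e false ↔-∘ y
      left-step : ∀ x₁ x₂ → CosetStep g x₁ x₂ →
                  CosetStep (blockwise g h) (ψ (S′ , x₁ , y₁)) (ψ (S′ , x₂ , y₁))
      left-step x₁ x₂ (inj₁ e′)       = inj₁ (ψ-≗ x₁ y₁ x₂ y₁ (cong proj₁ ∘ e′) (λ _ → refl))
      left-step x₁ x₂ (inj₂ (k , e′)) =
        inj₂ (inj₁ k , ψ-⊕ x₁ y₁ x₂ y₁ (g k) id (cong proj₁ ∘ e′) (λ _ → refl))
      right-step : ∀ y₂ y₃ → CosetStep h y₂ y₃ →
                   CosetStep (blockwise g h) (ψ (S′ , x′ , y₂)) (ψ (S′ , x′ , y₃))
      right-step y₂ y₃ (inj₁ e′)       = inj₁ (ψ-≗ x′ y₂ x′ y₃ (λ _ → refl) (cong proj₁ ∘ e′))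
      right-step y₂ y₃ (inj₂ (k , e′)) =
        inj₂ (inj₂ k , ψ-⊕ x′ y₂ x′ y₃ id (h k) (λ _ → refl) (cong proj₁ ∘ e′))

    side-ψ : ∀ {U} (S : U → Bool) x y u → side (ψ (S , x , y)) u ≡ S u
    side-ψ S x y u = begin
      isLeft (splitAt m (join m n w))  ≡⟨ cong isLeft (splitAt-join m n w) ⟩
      isLeft w                         ≡⟨ isLeft-map (from (partition↔ S) u) ⟩
      isLeft (from (partition↔ S) u)   ≡⟨ isLeft-partition S u ⟩
      S u                              ∎
      where
      w : Fin m ⊎ Fin n
      w = Sum.map (from x) (from y) (from (partition↔ S) u)

    ψφ-≗ : ∀ {U : Set} (l : Fin (m + n) ↔ U) → to l ≗ to (ψ (φ l))
    ψφ-≗ l i = begin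
      to l i                                                ≡⟨ cong (to l) (join-splitAt m n i) ⟨
      to l (join m n (splitAt m i))                         ≡⟨ [,]-∘ (to l) (splitAt m i) ⟩
      Sum.[ to l ∘ (_↑ˡ n) , to l ∘ (m ↑ʳ_) ] (splitAt m i)
        ≡⟨ to-ψ (restrictˡ (split l)) (restrictʳ (split l)) i ⟨
      to (ψ (φ l)) i                                        ∎

    ψ-natural-≗ : ∀ {U V : Set} (f : U ↔ V) (w : Tgt.Str U) → to (ψ (Tgt.act f w)) ≗ to f ∘ to (ψ w)
    ψ-natural-≗ f (S , x , y) i = begin
      to (ψ (Tgt.act f (S , x , y))) i
        ≡⟨ to-ψ (subAlong f S true ↔-∘ x) (subAlong f S false ↔-∘ y) i ⟩
      Sum.[ to f ∘ proj₁ ∘ to x , to f ∘ proj₁ ∘ to y ] (splitAt m i)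
        ≡⟨ [,]-∘ (to f) (splitAt m i) ⟨
      to f (Sum.[ proj₁ ∘ to x , proj₁ ∘ to y ] (splitAt m i))
        ≡⟨ cong (to f) (to-ψ x y i) ⟨
      to f (to (ψ (S , x , y)) i)
        ∎

  XnH-blockwise≃ : XnH (m + n) (blockwise g h) ≃ (XnH m g · XnH n h)
  XnH-blockwise≃ = record
    { φ          = φ
    ; ψ          = ψ
    ; φ-cong     = XnH-map-cong {g = blockwise g h} (·-lawful (XnH-lawful g) (XnH-lawful h))
                     φ φ-pointwise φ-generator
    ; ψ-cong     = ψ-cong
    ; ψφ         = λ l → coset-≗ (blockwise g h) (ψφ-≗ l)
    ; φψ         = λ { (S , x , y) →
        side-ψ S x y ,
        coset-≗ g (λ a → Sub-≡ (sym (ψ-↑ˡ x y a))) ,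
        coset-≗ h (λ b → Sub-≡ (sym (ψ-↑ʳ x y b))) }
    ; natural    = λ _ _ → (λ _ → refl) , coset-≗ g (λ _ → Sub-≡ refl) , coset-≗ h (λ _ → Sub-≡ refl)
    ; natural˘   = λ _ _ → (λ _ → refl) , coset-≗ g (λ _ → Sub-≡ refl) , coset-≗ h (λ _ → Sub-≡ refl)
    ; ψ-natural˘ = λ f w → coset-≗ (blockwise g h) (ψ-natural-≗ f w)
    }

-- Labellings of a grid

rot⁻¹ : ∀ {l} → Fin l → Fin l
rot⁻¹ {suc l} zero    = fromℕ l
rot⁻¹ {suc l} (suc x) = inject₁ x

rot-fromℕ : ∀ l → rot (fromℕ l) ≡ zero
rot-fromℕ l = toℕ-injective (begin
  toℕ (rot (fromℕ l))           ≡⟨ toℕ-fromℕ< _ ⟩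
  suc (toℕ (fromℕ l)) % suc l   ≡⟨ cong (λ k → suc k % suc l) (toℕ-fromℕ l) ⟩
  suc l % suc l                 ≡⟨ n%n≡0 (suc l) ⟩
  0                             ∎)

rot-inject₁ : ∀ {l} (x : Fin l) → rot (inject₁ x) ≡ suc x
rot-inject₁ {l} x = toℕ-injective (begin
  toℕ (rot (inject₁ x))          ≡⟨ toℕ-fromℕ< _ ⟩
  suc (toℕ (inject₁ x)) % suc l  ≡⟨ cong (λ k → suc k % suc l) (toℕ-inject₁ x) ⟩
  suc (toℕ x) % suc l            ≡⟨ m<n⇒m%n≡m (s≤s (toℕ<n x)) ⟩
  suc (toℕ x)                    ∎)

rot↔ : ∀ {l} → Fin l ↔ Fin l
rot↔ = mk↔ₛ′ rot rot⁻¹ rot-rot⁻¹ rot⁻¹-rot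
  where
  rot-rot⁻¹ : ∀ {l} (x : Fin l) → rot (rot⁻¹ x) ≡ x
  rot-rot⁻¹ {suc l} zero    = rot-fromℕ l
  rot-rot⁻¹ {suc l} (suc x) = rot-inject₁ x

  rot⁻¹-rot : ∀ {l} (x : Fin l) → rot⁻¹ (rot x) ≡ x
  rot⁻¹-rot {suc l} x with view x
  ... | ‵fromℕ     = cong rot⁻¹ (rot-fromℕ l)
  ... | ‵inject₁ y = cong rot⁻¹ (rot-inject₁ y)

↔-with-to : {A B : Set} (e : A ↔ B) (f : A → B) → f ≗ to e → A ↔ B
↔-with-to e f f≗e = mk↔ₛ′ f (from e)
  (λ y → trans (f≗e (from e y)) (strictlyInverseˡ e y))
  (λ x → trans (cong (from e) (f≗e x)) (strictlyInverseʳ e x))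

drop-inj₂ : ∀ {m} → Fin m ⊎ Fin 0 → Fin m
drop-inj₂ (inj₁ x) = x

+0↔ : ∀ {m} → Fin (m + 0) ↔ Fin m
+0↔ {m} = mk↔ₛ′ (drop-inj₂ ∘ splitAt m) (_↑ˡ 0)
  (λ y → cong drop-inj₂ (splitAt-↑ˡ m y 0))
  (λ x → trans (join-drop (splitAt m x)) (join-splitAt m 0 x))
  where
  join-drop : ∀ s → drop-inj₂ s ↑ˡ 0 ≡ join m 0 s
  join-drop (inj₁ _) = refl

+0↔-⊕ : ∀ {m} (f : Fin m → Fin m) (g : Fin 0 → Fin 0) x → to +0↔ ((f ⊕ g) x) ≡ f (to +0↔ x)
+0↔-⊕ {m} f g x =
  trans (cong drop-inj₂ (splitAt-join m 0 (Sum.map f g (splitAt m x)))) (drop-map (splitAt m x))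
  where
  drop-map : ∀ s → drop-inj₂ (Sum.map f g s) ≡ f (drop-inj₂ s)
  drop-map (inj₁ _) = refl

stdPerm-∷ : ∀ l β → stdPerm (l ∷ β) ≗ rot {l} ⊕ stdPerm β
stdPerm-∷ l β x with splitAt l x
... | inj₁ _ = refl
... | inj₂ _ = refl

cycle↔ : ∀ i → Fin (i + 0) ↔ Fin (i + 0)
cycle↔ i = ↔-with-to (↔-sym +0↔ ↔-∘ (rot↔ ↔-∘ +0↔)) (stdPerm (i ∷ [])) λ x → begin
  stdPerm (i ∷ []) x                ≡⟨ stdPerm-∷ i [] x ⟩
  (rot {i} ⊕ id) x                  ≡⟨ strictlyInverseʳ +0↔ _ ⟨
  to +0↔ ((rot {i} ⊕ id) x) ↑ˡ 0     ≡⟨ cong (_↑ˡ 0) (+0↔-⊕ rot id x) ⟩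
  rot (to +0↔ x) ↑ˡ 0               ∎

grid : ∀ {i a} → Fin a × Fin i → Fin (blk (i , a))
grid {i} {suc a} (zero  , r) = r ↑ˡ blk (i , a)
grid {i} {suc a} (suc c , r) = i ↑ʳ grid (c , r)

ungrid : ∀ {i} a → Fin (blk (i , a)) → Fin a × Fin i
ungrid {i} (suc a) x = Sum.[ (zero ,_) , Product.map₁ suc ∘ ungrid a ] (splitAt i x)

grid↔ : ∀ {i a} → (Fin a × Fin i) ↔ Fin (blk (i , a))
grid↔ {i} {a} = mk↔ₛ′ grid (ungrid a) (grid-ungrid a) (ungrid-grid a)
  where
  grid-ungrid : ∀ a x → grid {i} {a} (ungrid a x) ≡ x
  grid-ungrid (suc a) x = trans (grid-ungrid-join (splitAt i x)) (join-splitAt i (blk (i , a)) x)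
    where
    grid-ungrid-join : ∀ s →
      grid {i} {suc a} (Sum.[ (zero ,_) , Product.map₁ suc ∘ ungrid a ] s) ≡ join i _ s
    grid-ungrid-join (inj₁ _) = refl
    grid-ungrid-join (inj₂ z) = cong (i ↑ʳ_) (grid-ungrid a z)

  ungrid-grid : ∀ a (cr : Fin a × Fin i) → ungrid a (grid cr) ≡ cr
  ungrid-grid (suc a) (zero  , r) = cong Sum.[ _ , _ ] (splitAt-↑ˡ i r (blk (i , a)))
  ungrid-grid (suc a) (suc c , r) =
    trans (cong Sum.[ _ , _ ] (splitAt-↑ʳ i (blk (i , a)) (grid (c , r))))
          (cong (Product.map₁ suc) (ungrid-grid a (c , r)))

stdPerm-grid : ∀ {i a} (c : Fin a) (r : Fin i) →
               stdPerm (replicate a i) (grid (c , r)) ≡ grid (c , rot r)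
stdPerm-grid {i} {suc a} zero r =
  trans (stdPerm-∷ i (replicate a i) _) (⊕-↑ˡ rot (stdPerm (replicate a i)) r)
stdPerm-grid {i} {suc a} (suc c) r =
  trans (stdPerm-∷ i (replicate a i) _)
        (trans (⊕-↑ʳ rot (stdPerm (replicate a i)) _) (cong (i ↑ʳ_) (stdPerm-grid c r)))

Xpow-≈⇒≗ : ∀ {a} {U : Set} {l m : Fin a ↔ U} → Species._≈_ (Xpow a) l m → to l ≗ to m
Xpow-≈⇒≗ ε                          _ = refl
Xpow-≈⇒≗ (fwd (inj₁ e) ◅ rest)       i = trans (sym (e i)) (Xpow-≈⇒≗ rest i)
Xpow-≈⇒≗ (bwd (inj₁ e) ◅ rest)       i = trans (e i) (Xpow-≈⇒≗ rest i)
Xpow-≈⇒≗ (fwd (inj₂ (() , _)) ◅ _)   _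
Xpow-≈⇒≗ (bwd (inj₂ (() , _)) ◅ _)   _

module _ {A B U : Set} {r : ℕ} (p : U → Fin r) (x : B ↔ Fin r) (y : ∀ j → A ↔ Fib p j) where

  glue : (A × B) ↔ U
  glue = mk↔ₛ′ to′ from′ to′∘from′ from′∘to′
    where
    to′ : A × B → U
    to′ (c , b) = proj₁ (to (y (to x b)) c)

    from′ : U → A × B
    from′ u = from (y _) (u , sym (strictlyInverseˡ x (p u))) , from x (p u)

    to′∘from′ : ∀ u → to′ (from′ u) ≡ u
    to′∘from′ u = cong proj₁ (strictlyInverseˡ (y _) (u , sym (strictlyInverseˡ x (p u))))

    from-to-y : ∀ {j j′} → j ≡ j′ → ∀ c q → from (y j′) (proj₁ (to (y j) c) , q) ≡ c
    from-to-y {j} refl c q = trans (cong (from (y j)) (Fib-≡ refl)) (strictlyInverseʳ (y j) c)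

    from′∘to′ : ∀ cb → from′ (to′ cb) ≡ cb
    from′∘to′ (c , b) = cong₂ _,_
      (from-to-y (trans (sym q) (sym (strictlyInverseˡ x (p u)))) c _)
      (trans (cong (from x) q) (strictlyInverseʳ x b))
      where
      u : U
      u = proj₁ (to (y (to x b)) c)
      q : p u ≡ to x b
      q = proj₂ (to (y (to x b)) c)

module _ {n a N : ℕ} {I : Set} (cell : (Fin (suc a) × Fin n) ↔ Fin N)
         (g : I → Fin n ↔ Fin n) (h : I → Fin N → Fin N)
         (h-cell : ∀ k c r → h k (to cell (c , r)) ≡ to cell (c , to (g k) r)) where
  private
    module Src = Species (XnH N h)
    Tgt : Species
    Tgt = XnH n (λ k → to (g k)) ∘ₛ Xpow (suc a)
    module Tgt = Species Tgt

    row : Fin N → Fin (suc a)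
    row = proj₁ ∘ from cell

    col : Fin N → Fin n
    col = proj₂ ∘ from cell

    from-cell-h : ∀ k x → from cell (h k x) ≡ (row x , to (g k) (col x))
    from-cell-h k x = begin
      from cell (h k x)                         ≡⟨ cong (from cell ∘ h k) (strictlyInverseˡ cell x) ⟨
      from cell (h k (to cell (row x , col x)))  ≡⟨ cong (from cell) (h-cell k _ _) ⟩
      from cell (to cell (row x , to (g k) (col x))) ≡⟨ strictlyInverseʳ cell _ ⟩
      (row x , to (g k) (col x))                ∎

    column : ∀ j → Fin (suc a) ↔ Fib col j
    column j = mk↔ₛ′ (λ c → to cell (c , j) , cong proj₂ (strictlyInverseʳ cell (c , j))) (row ∘ proj₁)
      (λ { (x , q) →
        Fib-≡ (trans (cong (λ j′ → to cell (row x , j′)) (sym q)) (strictlyInverseˡ cell x)) })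
      (λ c → cong proj₁ (strictlyInverseʳ cell (c , j)))

    labels : ∀ {U : Set} → (Fin N ↔ U) → U → Fin n
    labels l = col ∘ from l

    fibre : ∀ {U : Set} (l : Fin N ↔ U) j → Fin (suc a) ↔ Fib (labels l) j
    fibre l j = fibAlong l col j ↔-∘ column j

    φ : ∀ {U} → Src.Str U → Tgt.Str U
    φ l = comp n (labels l) (λ j → to (fibre l j) zero) (↔-id _) (fibre l)

    ψ : ∀ {U} → Tgt.Str U → Src.Str U
    ψ (comp r p _ x y) = glue p x y ↔-∘ ↔-sym cell

    φ-pointwise : ∀ {U : Set} (l m : Fin N ↔ U) → to m ≗ to l → φ l Tgt.≈ φ m
    φ-pointwise l m m≗l =
      ↔-id _ , (λ u → cong col (from-≗ m l m≗l u)) , coset-≗ _ (λ _ → refl) ,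
      λ j → coset-≗ _ (λ c → Fib-≡ (m≗l _))

    φ-generator : ∀ {U : Set} (l m : Fin N ↔ U) k → (∀ i → to m i ≡ to l (h k i)) →
                  φ l Tgt.≈ φ m × φ m Tgt.≈ φ l
    φ-generator l m k eq =
      (↔-sym (g k) , labels-step˘ , coset-step _ k (λ i → sym (strictlyInverseʳ (g k) i)) ,
       λ j → coset-≗ _ (λ c → Fib-≡ (trans (eq _) (cong (to l) (trans (h-cell k c _)
                                   (cong (λ j′ → to cell (c , j′)) (strictlyInverseˡ (g k) j))))))) ,
      (g k , labels-step , coset-step˘ _ k (λ _ → refl) ,
       λ j → coset-≗ _ (λ c → Fib-≡ (sym (trans (eq _) (cong (to l) (h-cell k c j))))))
      where
      labels-step : ∀ u → labels l u ≡ to (g k) (labels m u)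
      labels-step u = begin
        col (from l u)                     ≡⟨ cong (col ∘ from l) (strictlyInverseˡ m u) ⟨
        col (from l (to m (from m u)))     ≡⟨ cong (col ∘ from l) (eq (from m u)) ⟩
        col (from l (to l (h k (from m u)))) ≡⟨ cong col (strictlyInverseʳ l _) ⟩
        col (h k (from m u))               ≡⟨ cong proj₂ (from-cell-h k (from m u)) ⟩
        to (g k) (labels m u)              ∎
      labels-step˘ : ∀ u → labels m u ≡ from (g k) (labels l u)
      labels-step˘ u = trans (sym (strictlyInverseʳ (g k) _)) (cong (from (g k)) (sym (labels-step u)))

    ψ-cong : ∀ {U} {w w′ : Tgt.Str U} → w Tgt.≈ w′ → ψ w Src.≈ ψ w′
    ψ-cong {w = comp r p s x y} {comp r′ p′ s′ x′ y′} (τ , e , x≈ , y≈) =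
      coset-≗ h (λ k → sym (cong proj₁ (Xpow-≈⇒≗ (y≈ (to x (col k))) (row k)))) ◅◅
      EqClosure.gmap (λ x₁ → ψ (comp r′ p′ s′ x₁ y′)) (λ {x₁} {x₂} → outer-step x₁ x₂) x≈
      where
      outer-step : ∀ x₁ x₂ → CosetStep (λ k → to (g k)) x₁ x₂ →
                   CosetStep h (ψ (comp r′ p′ s′ x₁ y′)) (ψ (comp r′ p′ s′ x₂ y′))
      outer-step x₁ x₂ (inj₁ e′) = inj₁ λ i → cong (λ j → proj₁ (to (y′ j) (row i))) (e′ (col i))
      outer-step x₁ x₂ (inj₂ (k , e′)) = inj₂ (k , λ i →
        trans (cong (λ j → proj₁ (to (y′ j) (row i))) (e′ (col i)))
              (cong (to (glue p′ x₁ y′)) (sym (from-cell-h k i))))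

  XnH-columnwise≃ : XnH N h ≃ (XnH n (λ k → to (g k)) ∘ₛ Xpow (suc a))
  XnH-columnwise≃ = record
    { φ          = φ
    ; ψ          = ψ
    ; φ-cong     = XnH-map-cong {g = h} (∘ₛ-lawful (XnH-lawful _) (XnH-lawful _))
                     φ φ-pointwise φ-generator
    ; ψ-cong     = λ {_} {w} {w′} → ψ-cong {w = w} {w′}
    ; ψφ         = λ l → coset-≗ h (λ i → cong (to l) (sym (strictlyInverseˡ cell i)))
    ; φψ         = λ { (comp r p s x y) →
        x , (λ u → sym (trans (cong (to x ∘ proj₂) (strictlyInverseʳ cell (from (glue p x y) u)))
                              (strictlyInverseˡ x (p u)))) ,
        coset-≗ _ (λ _ → refl) ,
        λ j → coset-≗ _ λ c →
          Fib-≡ (sym (cong (to (glue p x y)) (strictlyInverseʳ cell (c , j)))) }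
    ; natural    = λ _ _ →
        ↔-id _ , (λ _ → refl) , coset-≗ _ (λ _ → refl) , λ _ → coset-≗ _ (λ _ → Fib-≡ refl)
    ; natural˘   = λ _ _ →
        ↔-id _ , (λ _ → refl) , coset-≗ _ (λ _ → refl) , λ _ → coset-≗ _ (λ _ → Fib-≡ refl)
    ; ψ-natural˘ = λ { _ (comp r p s x y) → coset-≗ h (λ _ → refl) }
    }

-- The species K_α

K[]≃One : K [] ≃ One
K[]≃One = record
  { φ          = λ l u → ¬Fin0 (from l u)
  ; ψ          = ψ
  ; φ-cong     = λ _ → tt
  ; ψ-cong     = λ _ → coset-≗ (tau []) λ ()
  ; ψφ         = λ _ → coset-≗ (tau []) λ ()
  ; φψ         = λ _ → tt
  ; natural    = λ _ _ → tt
  ; natural˘   = λ _ _ → tt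
  ; ψ-natural˘ = λ _ _ → coset-≗ (tau []) λ ()
  }
  where
  ψ : ∀ {U} → (U → ⊥) → Fin 0 ↔ U
  ψ empty = mk↔ₛ′ (λ ()) (⊥-elim ∘ empty) (⊥-elim ∘ empty) (λ ())

tau-zero : ∀ i a α → tau ((i , a) ∷ α) zero ≗ stdPerm (replicate a i) ⊕ id
tau-zero i a α x with splitAt (blk (i , a)) x
... | inj₁ _ = refl
... | inj₂ _ = refl

tau-suc : ∀ p α j → tau (p ∷ α) (suc j) ≗ _⊕_ {blk p} id (tau α j)
tau-suc p α j x with splitAt (blk p) x
... | inj₁ _ = refl
... | inj₂ _ = refl

K-singleton≃ : ∀ i a → K ((i , a) ∷ []) ≃ C (replicate a i)
K-singleton≃ i a = XnH-conj (tau ((i , a) ∷ [])) (λ (_ : ⊤) → stdPerm (replicate a i)) +0↔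
                     (λ { zero → tt , intertwines }) (λ _ → zero , intertwines)
  where
  intertwines : ∀ x → stdPerm (replicate a i) (to +0↔ x) ≡ to +0↔ (tau ((i , a) ∷ []) zero x)
  intertwines x = sym (trans (cong (to +0↔) (tau-zero i a [] x)) (+0↔-⊕ _ id x))

K-cons≃ : ∀ i a α → K ((i , a) ∷ α) ≃ (C (replicate a i) · K α)
K-cons≃ i a α =
  ≃-trans (XnH-lawful _) (·-lawful (XnH-lawful _) (XnH-lawful _))
    (XnH-conj τ τ′ (↔-id _) forth back) (XnH-blockwise≃ _ _)
  where
  τ : Fin (length ((i , a) ∷ α)) → Fin (size ((i , a) ∷ α)) → Fin (size ((i , a) ∷ α))
  τ = tau ((i , a) ∷ α)
  τ′ : ⊤ ⊎ Fin (length α) → Fin (size ((i , a) ∷ α)) → Fin (size ((i , a) ∷ α))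
  τ′ = blockwise (λ _ → stdPerm (replicate a i)) (tau α)
  forth : ∀ k → Σ (⊤ ⊎ Fin (length α)) (Intertwines τ τ′ (↔-id _) k)
  forth zero    = inj₁ tt , sym ∘ tau-zero i a α
  forth (suc j) = inj₂ j , sym ∘ tau-suc (i , a) α j
  back : ∀ k′ → Σ (Fin (length ((i , a) ∷ α))) (λ k → Intertwines τ τ′ (↔-id _) k k′)
  back (inj₁ _) = zero , sym ∘ tau-zero i a α
  back (inj₂ j) = suc j , sym ∘ tau-suc (i , a) α j

C-rectangle≃ : ∀ i a → C (replicate (suc a) i) ≃ (C (i ∷ []) ∘ₛ Xpow (suc a))
C-rectangle≃ i a = XnH-columnwise≃ (grid↔ ↔-∘ (↔-id _ ×-↔ +0↔)) (λ (_ : ⊤) → cycle↔ i)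
                     (λ _ → stdPerm (replicate (suc a) i)) cell-rot
  where
  cell-rot : ∀ (_ : ⊤) c r → stdPerm (replicate (suc a) i) (grid (c , to +0↔ r)) ≡
                             grid (c , to +0↔ (stdPerm (i ∷ []) r))
  cell-rot _ c r = begin
    stdPerm (replicate (suc a) i) (grid (c , to +0↔ r))  ≡⟨ stdPerm-grid c (to +0↔ r) ⟩
    grid (c , rot (to +0↔ r))                           ≡⟨ cong (grid ∘ (c ,_)) (+0↔-⊕ rot id r) ⟨
    grid (c , to +0↔ ((rot {i} ⊕ id) r))                ≡⟨ cong (grid ∘ (c ,_) ∘ to +0↔) (stdPerm-∷ i [] r) ⟨
    grid (c , to +0↔ (stdPerm (i ∷ []) r))              ∎

C∘X : ℕ × ℕ → Species
C∘X p = C (proj₁ p ∷ []) ∘ₛ Xpow (proj₂ p)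

C∘X-lawful : ∀ p → Lawful (C∘X p)
C∘X-lawful p = ∘ₛ-lawful (XnH-lawful _) (XnH-lawful _)

∏-lawful : ∀ ps → Lawful (prod (map C∘X ps))
∏-lawful []           = One-lawful
∏-lawful (p ∷ [])     = C∘X-lawful p
∏-lawful (p ∷ q ∷ ps) = ·-lawful (C∘X-lawful p) (∏-lawful (q ∷ ps))

K≃∏ : ∀ α → All (λ p → 1 ≤ proj₂ p) α → K α ≃ prod (map C∘X α)
K≃∏ []                         []      = K[]≃One
K≃∏ ((i , zero) ∷ _)           (() ∷ _)
K≃∏ ((i , suc a) ∷ [])         (_ ∷ _) =
  ≃-trans (XnH-lawful _) (C∘X-lawful (i , suc a)) (K-singleton≃ i (suc a)) (C-rectangle≃ i a)
K≃∏ ((i , suc a) ∷ q ∷ α)      (_ ∷ α≥1) =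
  ≃-trans (XnH-lawful _) (∏-lawful ((i , suc a) ∷ q ∷ α)) (K-cons≃ i (suc a) (q ∷ α))
    (·-cong (XnH-lawful _) (XnH-lawful _) (C∘X-lawful (i , suc a)) (∏-lawful (q ∷ α))
            (C-rectangle≃ i a) (K≃∏ (q ∷ α) α≥1))

mainTheorem4 : (α : List (ℕ × ℕ)) →
    All (λ p → 1 ≤ proj₁ p × 1 ≤ proj₂ p) α →
    Unique (map proj₁ α) →
    K α ≅ₛ prod (map (λ p → C (proj₁ p ∷ []) ∘ₛ Xpow (proj₂ p)) α)
-- Positive multiplicities are:
-- C_{(i)}(X^0) has no structures, the blocks of a composite being nonempty.
mainTheorem4 α α≥1 _ = ≃⇒≅ₛ (K≃∏ α (All.map proj₂ α≥1))
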